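{- For $n\ge2$, the number of vertices of the flow polytope $\mathcal{F}_{K_{n+1}}(1,1,0,\ldots,0,-2)$ is $2\cdot3^{n-2}$.
   Context: $K_{n+1}$ is the complete graph on $[n+1]$ with one edge $(i,j)$ for each $1\le i<j\le n+1$. For an integer vector $\mathbf a=(a_1,\dots,a_{n+1})$ with entries summing to $0$, the flow polytope $\mathcal{F}_{K_{n+1}}(\mathbf a)\subset\mathbb{R}^{\binom{n+1}2}$ is the set of nonnegative real weightings $(f_{ij})_{i<j}$ of the edges such that for each vertex $i$, $\sum_{g<i}f_{gi}+a_i=\sum_{j>i}f_{ij}$.
   Formalization: The edge weightings $(f_{ij})_{i<j}$ are rational rather than real, both for points of the flow polytope and for the points tested when deciding whether a point is a vertex. -}

module Defs where

open import Data.Nat as ℕ using (ℕ; zero; suc)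
open import Data.Integer as ℤ using (ℤ; +_; -[1+_])
open import Data.Rational using (ℚ; 0ℚ; 1ℚ; _+_; _*_; _-_; _≤_; _<_; _/_)
open import Data.Fin as Fin using (Fin; toℕ)
open import Data.Fin.Properties using (_<?_)
open import Data.Product using (Σ; Σ-syntax; _,_; _×_; ∃-syntax)
open import Data.List using (List; length)
open import Data.List.Relation.Unary.All using (All)
open import Data.List.Relation.Unary.Any using (Any)
open import Data.List.Relation.Unary.AllPairs using (AllPairs)
open import Relation.Binary.PropositionalEquality using (_≡_)
open import Relation.Nullary using (Dec; yes; no; ¬_)

-- Edges (i , j) with i < j of the complete graph on the vertex set Fin k.
Edge : ℕ → Set
Edge k = Σ[ i ∈ Fin k ] Σ[ j ∈ Fin k ] (i Fin.< j)

Flow : ℕ → Set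
Flow k = Edge k → ℚ

_≈_ : ∀ {k} → Flow k → Flow k → Set
f ≈ g = ∀ e → f e ≡ g e

sumℚ : ∀ {k} → (Fin k → ℚ) → ℚ
sumℚ {zero}  h = 0ℚ
sumℚ {suc k} h = h Fin.zero + sumℚ (λ i → h (Fin.suc i))

edgeVal : ∀ {k} → Flow k → (i j : Fin k) → Dec (i Fin.< j) → ℚ
edgeVal f i j (yes p) = f (i , j , p)
edgeVal f i j (no _)  = 0ℚ

inflow : ∀ {k} → Flow k → Fin k → ℚ
inflow f v = sumℚ (λ g → edgeVal f g v (g <? v))

outflow : ∀ {k} → Flow k → Fin k → ℚ
outflow f v = sumℚ (λ j → edgeVal f v j (v <? j))

toℚ : ℤ → ℚ
toℚ z = z / 1

InFlowPolytope : ∀ {k} → (Fin k → ℤ) → Flow k → Set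
InFlowPolytope {k} a f =
  (∀ e → 0ℚ ≤ f e) × (∀ v → inflow f v + toℚ (a v) ≡ outflow f v)

convex : ∀ {k} → ℚ → Flow k → Flow k → Flow k
convex t g h e = t * g e + (1ℚ - t) * h e

IsVertex : ∀ {k} → (Fin k → ℤ) → Flow k → Set
IsVertex a f = InFlowPolytope a f ×
  (∀ g h t → InFlowPolytope a g → InFlowPolytope a h →
     0ℚ < t → t < 1ℚ → f ≈ convex t g h → g ≈ h)

HasNumVertices : ∀ {k} → (Fin k → ℤ) → ℕ → Set
HasNumVertices {k} a N = ∃[ L ]
  ( (length L ≡ N)
  × All (IsVertex a) L
  × AllPairs (λ f g → ¬ (f ≈ g)) L
  × (∀ f → IsVertex a f → Any (λ g → f ≈ g) L) )

aVec : (n : ℕ) → Fin (suc n) → ℤ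
aVec n v with toℕ v
... | 0 = + 1
... | 1 = + 1
... | m with m ℕ.≟ n
...   | yes _ = -[1+ 1 ]
...   | no _  = + 0

{-# OPTIONS --safe #-}
module Submission where

-- Work with rational net flows b that are nonnegative away from the sink.  At a vertex f of
-- F(b), vertex 0 sends all of b₀ along a single edge (0, j): if two edges out of 0 carried
-- flow, f would dominate two different flows of the same small value ε from 0 to the sink,
-- P through one edge and Q through the other, and then f ± ½(P − Q) would exhibit f as a
-- midpoint.  Hence the vertices of F(b) are the joins of b₀ on the edge (0, j) with the
-- vertices of the flow polytope of the K_k spanned by 1, …, k for the residual net flow.
-- Starting from (1,1,0,…,0,−2), every residual net flow is δᵢ + δⱼ − 2δ_sink, so the vertex
-- counts satisfy a recursion in (i, j) whose first-row sums triple at every step.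

open import Defs
open import Data.Fin as Fin using (Fin; zero; suc; fromℕ; inject₁; toℕ)
import Data.Fin.Properties as Fin
open import Data.List using (List; []; _∷_; length; map; concat; tabulate)
open import Data.List.Properties using (length-++; length-map; tabulate-cong)
open import Data.List.Relation.Unary.All as All using (All; []; _∷_)
import Data.List.Relation.Unary.All.Properties as All
open import Data.List.Relation.Unary.Any as Any using (Any; here)
import Data.List.Relation.Unary.Any.Properties as Any
open import Data.List.Relation.Unary.AllPairs as AllPairs using (AllPairs; []; _∷_)
import Data.List.Relation.Unary.AllPairs.Properties as AllPairs
open import Data.Nat using (ℕ; zero; suc; z<s; s<s)
import Data.Nat as ℕ
open import Data.Nat.ListAction using (sum)
open import Data.Product using (Σ-syntax; ∃-syntax; _×_; _,_; proj₁; proj₂)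
open import Function using (_∘_)
open import Relation.Binary.PropositionalEquality
open import Relation.Nullary using (¬_)

module _ {A : Set} (_~_ : A → A → Set) where

  IsEnumeration : (A → Set) → List A → Set
  IsEnumeration P xs =
    All P xs × AllPairs (λ x y → ¬ x ~ y) xs × (∀ x → P x → Any (λ y → x ~ y) xs)

  IsEnumeration-cong : ∀ {P Q : A → Set} {xs} → (∀ x → P x → Q x) → (∀ x → Q x → P x) →
                       IsEnumeration P xs → IsEnumeration Q xs
  IsEnumeration-cong P⇒Q Q⇒P (all , distinct , complete) =
    All.map (P⇒Q _) all , distinct , λ x → complete x ∘ Q⇒P x

  IsEnumeration-concat : ∀ {m} {P : Fin m → A → Set} (xss : Fin m → List A) →
                         (∀ i → IsEnumeration (P i) (xss i)) →
                         (∀ {i j x y} → i ≢ j → P i x → P j y → ¬ x ~ y) →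
                         IsEnumeration (λ x → ∃[ i ] P i x) (concat (tabulate xss))
  IsEnumeration-concat {P = P} xss enum disjoint =
    All.concat⁺ (All.tabulate⁺ λ i → All.map (i ,_) (all i)) ,
    AllPairs.concat⁺ (All.tabulate⁺ (proj₁ ∘ proj₂ ∘ enum)) (AllPairs.tabulate⁺ across) ,
    λ { x (i , px) → Any.concat⁺ (Any.tabulate⁺ i (proj₂ (proj₂ (enum i)) x px)) }
    where
    all : ∀ i → All (P i) (xss i)
    all = proj₁ ∘ enum
    across : ∀ {i j} → i ≢ j → All (λ x → All (λ y → ¬ x ~ y) (xss j)) (xss i)
    across i≢j = All.map (λ px → All.map (disjoint i≢j px) (all _)) (all _)

length-concat-tabulate : ∀ {A : Set} {m} (xss : Fin m → List A) →
                         length (concat (tabulate xss)) ≡ sum (tabulate (length ∘ xss))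
length-concat-tabulate {m = zero}  xss = refl
length-concat-tabulate {m = suc m} xss =
  trans (length-++ (xss zero)) (cong (length (xss zero) ℕ.+_) (length-concat-tabulate (xss ∘ suc)))

module FlowPolytopeVertices where

  open import Data.Rational using (ℚ; 0ℚ; 1ℚ; ½; -½; _+_; _-_; -_; _*_; 1/_; _≤_; _<_; _⊓_)
  import Data.Rational as ℚ
  import Data.Rational.Properties as ℚ
  open import Data.Rational.Solver using (module +-*-Solver)
  open +-*-Solver using (solve; _:=_; _:+_; _:-_; :-_; _:*_; con)
  open import Data.Empty using (⊥; ⊥-elim)
  open import Data.Sum using ([_,_]′)
  open import Data.Unit using (tt)
  open import Relation.Nullary using (Dec; yes; no)
  open import Relation.Nullary.Decidable using (toWitness)

  *-nonNeg : ∀ {p q} → 0ℚ ≤ p → 0ℚ ≤ q → 0ℚ ≤ p * q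
  *-nonNeg {p} {q} 0≤p 0≤q =
    ℚ.nonNegative⁻¹ (p * q) {{ℚ.nonNeg*nonNeg⇒nonNeg p {{ℚ.nonNegative 0≤p}} q {{ℚ.nonNegative 0≤q}}}}

  +-nonNeg : ∀ {p q} → 0ℚ ≤ p → 0ℚ ≤ q → 0ℚ ≤ p + q
  +-nonNeg = ℚ.+-mono-≤

  p≤q⇒0≤q-p : ∀ {p q} → p ≤ q → 0ℚ ≤ q - p
  p≤q⇒0≤q-p {p} {q} p≤q = subst (_≤ q - p) (ℚ.+-inverseʳ p) (ℚ.+-monoˡ-≤ (- p) p≤q)

  p<q⇒0<q-p : ∀ {p q} → p < q → 0ℚ < q - p
  p<q⇒0<q-p {p} {q} p<q = subst (_< q - p) (ℚ.+-inverseʳ p) (ℚ.+-monoˡ-< (- p) p<q)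

  p≤q+p : ∀ {p q} → 0ℚ ≤ q → p ≤ q + p
  p≤q+p {p} {q} 0≤q = subst (_≤ q + p) (ℚ.+-identityˡ p) (ℚ.+-monoˡ-≤ p 0≤q)

  nonNeg+nonNeg≡0⇒≡0 : ∀ {p q} → 0ℚ ≤ p → 0ℚ ≤ q → p + q ≡ 0ℚ → p ≡ 0ℚ
  nonNeg+nonNeg≡0⇒≡0 {p} 0≤p 0≤q p+q≡0 =
    ℚ.≤-antisym (subst₂ _≤_ (ℚ.+-identityʳ p) p+q≡0 (ℚ.+-monoʳ-≤ p 0≤q)) 0≤p

  pos*nonNeg≡0⇒≡0 : ∀ {s z} → 0ℚ < s → 0ℚ ≤ z → s * z ≡ 0ℚ → z ≡ 0ℚ
  pos*nonNeg≡0⇒≡0 {s} {z} 0<s 0≤z sz≡0 = ℚ.≤-antisym z≤0 0≤z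
    where
    z≤0 = ℚ.*-cancelˡ-≤-pos s {{ℚ.positive 0<s}}
            (subst (s * z ≤_) (sym (ℚ.*-zeroʳ s)) (ℚ.≤-reflexive sz≡0))

  convex≡0 : ∀ {t x y} → 0ℚ ≤ x → 0ℚ ≤ y → 0ℚ < t → t < 1ℚ →
             t * x + (1ℚ - t) * y ≡ 0ℚ → x ≡ 0ℚ × y ≡ 0ℚ
  convex≡0 {t} {x} {y} 0≤x 0≤y 0<t t<1 sum≡0 =
    pos*nonNeg≡0⇒≡0 0<t 0≤x tx≡0 , pos*nonNeg≡0⇒≡0 0<1-t 0≤y sy≡0
    where
    0<1-t = p<q⇒0<q-p t<1
    0≤tx = *-nonNeg (ℚ.<⇒≤ 0<t) 0≤x
    0≤sy = *-nonNeg (ℚ.<⇒≤ 0<1-t) 0≤y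
    tx≡0 = nonNeg+nonNeg≡0⇒≡0 0≤tx 0≤sy sum≡0
    sy≡0 = nonNeg+nonNeg≡0⇒≡0 0≤sy 0≤tx (trans (ℚ.+-comm ((1ℚ - t) * y) (t * x)) sum≡0)

  *-≤-self : ∀ {r x} → r ≤ 1ℚ → 0ℚ ≤ x → r * x ≤ x
  *-≤-self {r} {x} r≤1 0≤x =
    subst (r * x ≤_) (ℚ.*-identityˡ x) (ℚ.*-monoʳ-≤-nonNeg x {{ℚ.nonNegative 0≤x}} r≤1)

  unit-interval-ratio : ∀ {p q} → 0ℚ ≤ p → p ≤ q → Σ[ r ∈ ℚ ] 0ℚ ≤ r × r ≤ 1ℚ × r * q ≡ p
  unit-interval-ratio {p} {q} 0≤p p≤q with 0ℚ ℚ.<? q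
  ... | no 0≮q = 0ℚ , ℚ.≤-refl , ℚ.nonNegative⁻¹ 1ℚ , trans (ℚ.*-zeroˡ q) (sym p≡0)
    where
    p≡0 = ℚ.≤-antisym (ℚ.≤-trans p≤q (ℚ.≮⇒≥ 0≮q)) 0≤p
  ... | yes 0<q = r , 0≤r , r≤1 , rq≡p
    where
    instance
      q-positive : ℚ.Positive q
      q-positive = ℚ.positive 0<q
      q-nonZero : ℚ.NonZero q
      q-nonZero = ℚ.pos⇒nonZero q
    r = p * 1/ q
    rq≡p : r * q ≡ p
    rq≡p = trans (ℚ.*-assoc p (1/ q) q) (trans (cong (p *_) (ℚ.*-inverseˡ q)) (ℚ.*-identityʳ p))
    0≤r = ℚ.*-cancelʳ-≤-pos q (subst₂ _≤_ (sym (ℚ.*-zeroˡ q)) (sym rq≡p) 0≤p)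
    r≤1 = ℚ.*-cancelʳ-≤-pos q (subst₂ _≤_ (sym rq≡p) (sym (ℚ.*-identityˡ q)) p≤q)

  sumℚ-cong : ∀ {k} {x y : Fin k → ℚ} → x ≗ y → sumℚ x ≡ sumℚ y
  sumℚ-cong {zero}  x≗y = refl
  sumℚ-cong {suc k} x≗y = cong₂ _+_ (x≗y zero) (sumℚ-cong (x≗y ∘ suc))

  sumℚ-0 : ∀ {k} → sumℚ {k} (λ _ → 0ℚ) ≡ 0ℚ
  sumℚ-0 {zero}  = refl
  sumℚ-0 {suc k} = trans (cong (0ℚ +_) (sumℚ-0 {k})) (ℚ.+-identityˡ 0ℚ)

  sumℚ-scale : ∀ {k} a (x : Fin k → ℚ) → sumℚ (λ i → a * x i) ≡ a * sumℚ x
  sumℚ-scale {zero}  a x = sym (ℚ.*-zeroʳ a)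
  sumℚ-scale {suc k} a x =
    trans (cong (a * x zero +_) (sumℚ-scale a (x ∘ suc)))
          (sym (ℚ.*-distribˡ-+ a (x zero) (sumℚ (x ∘ suc))))

  sumℚ-+ : ∀ {k} (x y : Fin k → ℚ) → sumℚ (λ i → x i + y i) ≡ sumℚ x + sumℚ y
  sumℚ-+ {zero}  x y = refl
  sumℚ-+ {suc k} x y =
    trans (cong (x zero + y zero +_) (sumℚ-+ (x ∘ suc) (y ∘ suc)))
          (interchange (x zero) (y zero) (sumℚ (x ∘ suc)) (sumℚ (y ∘ suc)))
    where
    interchange : ∀ a b c d → (a + b) + (c + d) ≡ (a + c) + (b + d)
    interchange = solve 4 (λ a b c d → (a :+ b) :+ (c :+ d) := (a :+ c) :+ (b :+ d)) refl

  sumℚ-linear : ∀ {k} a b (x y : Fin k → ℚ) →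
                sumℚ (λ i → a * x i + b * y i) ≡ a * sumℚ x + b * sumℚ y
  sumℚ-linear a b x y =
    trans (sumℚ-+ (λ i → a * x i) (λ i → b * y i)) (cong₂ _+_ (sumℚ-scale a x) (sumℚ-scale b y))

  δ : ∀ {n} → Fin n → Fin n → ℚ
  δ zero    zero    = 1ℚ
  δ zero    (suc _) = 0ℚ
  δ (suc _) zero    = 0ℚ
  δ (suc i) (suc j) = δ i j

  δ-diag : ∀ {n} (i : Fin n) → δ i i ≡ 1ℚ
  δ-diag zero    = refl
  δ-diag (suc i) = δ-diag i

  δ-offdiag : ∀ {n} {i j : Fin n} → i ≢ j → δ i j ≡ 0ℚ
  δ-offdiag {i = zero}  {zero}  i≢j = ⊥-elim (i≢j refl)
  δ-offdiag {i = zero}  {suc j} i≢j = refl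
  δ-offdiag {i = suc i} {zero}  i≢j = refl
  δ-offdiag {i = suc i} {suc j} i≢j = δ-offdiag (i≢j ∘ cong suc)

  δ-nonNeg : ∀ {n} (i j : Fin n) → 0ℚ ≤ δ i j
  δ-nonNeg i j with i Fin.≟ j
  ... | yes refl = subst (0ℚ ≤_) (sym (δ-diag i)) (ℚ.nonNegative⁻¹ 1ℚ)
  ... | no i≢j   = subst (0ℚ ≤_) (sym (δ-offdiag i≢j)) ℚ.≤-refl

  δ-fromℕ-inject₁ : ∀ {m} (v : Fin m) → δ (fromℕ m) (inject₁ v) ≡ 0ℚ
  δ-fromℕ-inject₁ zero    = refl
  δ-fromℕ-inject₁ (suc v) = δ-fromℕ-inject₁ v

  sumℚ-δ : ∀ {n} (i : Fin n) → sumℚ (δ i) ≡ 1ℚ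
  sumℚ-δ {suc n} zero    = trans (cong (1ℚ +_) (sumℚ-0 {n})) (ℚ.+-identityʳ 1ℚ)
  sumℚ-δ {suc n} (suc i) = trans (ℚ.+-identityˡ _) (sumℚ-δ i)

  infixl 7 _·δ_
  _·δ_ : ∀ {n} → ℚ → Fin n → Fin n → ℚ
  (s ·δ j) i = s * δ j i

  sumℚ-·δ : ∀ {n} s (j : Fin n) → sumℚ (s ·δ j) ≡ s
  sumℚ-·δ s j = trans (sumℚ-scale s (δ j)) (trans (cong (s *_) (sumℚ-δ j)) (ℚ.*-identityʳ s))

  ·δ-nonNeg : ∀ {n s} (j : Fin n) → 0ℚ ≤ s → ∀ i → 0ℚ ≤ (s ·δ j) i
  ·δ-nonNeg j 0≤s i = *-nonNeg 0≤s (δ-nonNeg j i)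

  ·δ-diag : ∀ {n} s (j : Fin n) → (s ·δ j) j ≡ s
  ·δ-diag s j = trans (cong (s *_) (δ-diag j)) (ℚ.*-identityʳ s)

  ·δ-offdiag : ∀ {n} s {i j : Fin n} → j ≢ i → (s ·δ j) i ≡ 0ℚ
  ·δ-offdiag s j≢i = trans (cong (s *_) (δ-offdiag j≢i)) (ℚ.*-zeroʳ s)

  ·δ-≤ : ∀ {n s} {x : Fin n → ℚ} j → 0ℚ ≤ s → s ≤ x j → (∀ i → 0ℚ ≤ x i) →
         ∀ i → (s ·δ j) i ≤ x i
  ·δ-≤ {s = s} {x} j 0≤s s≤xj 0≤x i with j Fin.≟ i
  ... | yes refl = subst (_≤ x j) (sym (·δ-diag s j)) s≤xj
  ... | no j≢i   = subst (_≤ x i) (sym (·δ-offdiag s j≢i)) (0≤x i)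

  ·δ-separates : ∀ {n s} {j j′ : Fin n} {x y : Fin n → ℚ} → j ≢ j′ →
                 x ≗ s ·δ j → y ≗ s ·δ j′ → x j ≡ y j → s ≡ 0ℚ
  ·δ-separates {s = s} {j} {j′} {x} {y} j≢j′ x≗ y≗ xj≡yj = begin
    s              ≡⟨ sym (·δ-diag s j) ⟩
    (s ·δ j) j     ≡⟨ sym (x≗ j) ⟩
    x j            ≡⟨ xj≡yj ⟩
    y j            ≡⟨ y≗ j ⟩
    (s ·δ j′) j    ≡⟨ ·δ-offdiag s (j≢j′ ∘ sym) ⟩
    0ℚ             ∎
    where open ≡-Reasoning

  concentrated : ∀ {n} (x : Fin n → ℚ) j → (∀ i → i ≢ j → x i ≡ 0ℚ) → x ≗ sumℚ x ·δ j
  concentrated x j off i = trans (x≗ i) (cong (λ s → (s ·δ j) i) (sym Σx≡xj))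
    where
    x≗ : x ≗ x j ·δ j
    x≗ i with j Fin.≟ i
    ... | yes refl = sym (·δ-diag (x j) j)
    ... | no j≢i   = trans (off i (j≢i ∘ sym)) (sym (·δ-offdiag (x j) j≢i))
    Σx≡xj : sumℚ x ≡ x j
    Σx≡xj = trans (sumℚ-cong x≗) (sumℚ-·δ (x j) j)

  row₀ : ∀ {k} → Flow (suc k) → Fin k → ℚ
  row₀ f j = f (zero , suc j , z<s)

  rest : ∀ {k} → Flow (suc k) → Flow k
  rest f (i , j , i<j) = f (suc i , suc j , s<s i<j)

  join : ∀ {k} → (Fin k → ℚ) → Flow k → Flow (suc k)
  join r g (zero  , zero  , ())
  join r g (zero  , suc j , z<s)     = r j
  join r g (suc i , zero  , ())
  join r g (suc i , suc j , s<s i<j) = g (i , j , i<j)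

  edgewise : ∀ {k} (R : ℚ → ℚ → Set) {f g : Flow (suc k)} →
             (∀ j → R (row₀ f j) (row₀ g j)) → (∀ e → R (rest f e) (rest g e)) → ∀ e → R (f e) (g e)
  edgewise R rows rests (zero  , zero  , ())
  edgewise R rows rests (zero  , suc j , z<s)     = rows j
  edgewise R rows rests (suc i , zero  , ())
  edgewise R rows rests (suc i , suc j , s<s i<j) = rests (i , j , i<j)

  ≈-from-row₀-rest : ∀ {k} {f g : Flow (suc k)} → row₀ f ≗ row₀ g → rest f ≈ rest g → f ≈ g
  ≈-from-row₀-rest = edgewise _≡_

  K₁-elim : {P : Edge 1 → Set} → ∀ e → P e
  K₁-elim (zero , zero , ())

  edgeVal-irrelevant : ∀ {k} (f : Flow k) i j (d d′ : Dec (i Fin.< j)) → edgeVal f i j d ≡ edgeVal f i j d′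
  edgeVal-irrelevant f i j (yes i<j) (yes i<j′) = cong (λ p → f (i , j , p)) (Fin.<-irrelevant i<j i<j′)
  edgeVal-irrelevant f i j (yes i<j) (no i≮j)   = ⊥-elim (i≮j i<j)
  edgeVal-irrelevant f i j (no i≮j)  (yes i<j)  = ⊥-elim (i≮j i<j)
  edgeVal-irrelevant f i j (no _)    (no _)     = refl

  edgeVal-into-zero : ∀ {k} (f : Flow (suc k)) i d → edgeVal f i zero d ≡ 0ℚ
  edgeVal-into-zero f i (no _) = refl

  edgeVal-row₀ : ∀ {k} (f : Flow (suc k)) j d → edgeVal f zero (suc j) d ≡ row₀ f j
  edgeVal-row₀ f j d = edgeVal-irrelevant f zero (suc j) d (yes z<s)

  edgeVal-rest : ∀ {k} (f : Flow (suc k)) i j d d′ → edgeVal f (suc i) (suc j) d ≡ edgeVal (rest f) i j d′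
  edgeVal-rest f i j d (yes i<j) = edgeVal-irrelevant f (suc i) (suc j) d (yes (s<s i<j))
  edgeVal-rest f i j d (no i≮j)  = edgeVal-irrelevant f (suc i) (suc j) d (no (i≮j ∘ ℕ.s<s⁻¹))

  linComb : ∀ {A : Set} → ℚ → (A → ℚ) → ℚ → (A → ℚ) → A → ℚ
  linComb a x b y e = a * x e + b * y e

  edgeVal-linear : ∀ {k} a b (f g : Flow k) i j d →
                   edgeVal (linComb a f b g) i j d ≡ a * edgeVal f i j d + b * edgeVal g i j d
  edgeVal-linear a b f g i j (yes _) = refl
  edgeVal-linear a b f g i j (no _)  = solve 2 (λ a b → con 0ℚ := a :* con 0ℚ :+ b :* con 0ℚ) refl a b

  inflow-zero : ∀ {k} (f : Flow (suc k)) → inflow f zero ≡ 0ℚ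
  inflow-zero {k} f =
    trans (sumℚ-cong λ i → edgeVal-into-zero f i (i Fin.<? zero {k})) (sumℚ-0 {suc k})

  outflow-zero : ∀ {k} (f : Flow (suc k)) → outflow f zero ≡ sumℚ (row₀ f)
  outflow-zero {k} f =
    trans (cong₂ _+_ (edgeVal-into-zero f zero (zero {k} Fin.<? zero {k}))
                     (sumℚ-cong λ j → edgeVal-row₀ f j (zero {k} Fin.<? suc j)))
          (ℚ.+-identityˡ _)

  inflow-suc : ∀ {k} (f : Flow (suc k)) v → inflow f (suc v) ≡ row₀ f v + inflow (rest f) v
  inflow-suc {k} f v =
    cong₂ _+_ (edgeVal-row₀ f v (zero {k} Fin.<? suc v))
              (sumℚ-cong λ i → edgeVal-rest f i v (suc i Fin.<? suc v) (i Fin.<? v))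

  outflow-suc : ∀ {k} (f : Flow (suc k)) v → outflow f (suc v) ≡ outflow (rest f) v
  outflow-suc {k} f v =
    trans (cong₂ _+_ (edgeVal-into-zero f (suc v) (suc v Fin.<? zero {k}))
                     (sumℚ-cong λ j → edgeVal-rest f v j (suc v Fin.<? suc j) (v Fin.<? j)))
          (ℚ.+-identityˡ _)

  inflow-linear : ∀ {k} a b (f g : Flow k) v →
                  inflow (linComb a f b g) v ≡ linComb a (inflow f) b (inflow g) v
  inflow-linear a b f g v =
    trans (sumℚ-cong λ i → edgeVal-linear a b f g i v (i Fin.<? v))
          (sumℚ-linear a b (λ i → edgeVal f i v (i Fin.<? v)) (λ i → edgeVal g i v (i Fin.<? v)))

  outflow-linear : ∀ {k} a b (f g : Flow k) v →
                   outflow (linComb a f b g) v ≡ linComb a (outflow f) b (outflow g) v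
  outflow-linear a b f g v =
    trans (sumℚ-cong λ j → edgeVal-linear a b f g v j (v Fin.<? j))
          (sumℚ-linear a b (λ j → edgeVal f v j (v Fin.<? j)) (λ j → edgeVal g v j (v Fin.<? j)))

  NonNeg : ∀ {k} → Flow k → Set
  NonNeg f = ∀ e → 0ℚ ≤ f e

  Conserves : ∀ {k} → (Fin k → ℚ) → Flow k → Set
  Conserves b f = ∀ v → inflow f v + b v ≡ outflow f v

  InPolytope : ∀ {k} → (Fin k → ℚ) → Flow k → Set
  InPolytope b f = NonNeg f × Conserves b f

  Extreme : ∀ {k} → (Fin k → ℚ) → Flow k → Set
  Extreme b f =
    ∀ g h t → InPolytope b g → InPolytope b h → 0ℚ < t → t < 1ℚ → f ≈ convex t g h → g ≈ h

  IsVertexℚ : ∀ {k} → (Fin k → ℚ) → Flow k → Set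
  IsVertexℚ b f = InPolytope b f × Extreme b f

  -- For b = toℚ ∘ a these unfold to InFlowPolytope a, IsVertex a and HasNumVertices a.
  HasNumVerticesℚ : ∀ {k} → (Fin k → ℚ) → ℕ → Set
  HasNumVerticesℚ b N = ∃[ L ] length L ≡ N × IsEnumeration _≈_ (IsVertexℚ b) L

  NonNegExceptSink : ∀ {m} → (Fin (suc m) → ℚ) → Set
  NonNegExceptSink {m} c = ∀ (v : Fin m) → 0ℚ ≤ c (inject₁ v)

  residual : ∀ {k} → (Fin (suc k) → ℚ) → (Fin k → ℚ) → Fin k → ℚ
  residual b r v = b (suc v) + r v

  NonNeg-rest : ∀ {k} {f : Flow (suc k)} → NonNeg f → NonNeg (rest f)
  NonNeg-rest 0≤f (i , j , i<j) = 0≤f (suc i , suc j , s<s i<j)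

  NonNeg-join : ∀ {k} {r : Fin k → ℚ} {g} → (∀ j → 0ℚ ≤ r j) → NonNeg g → NonNeg (join r g)
  NonNeg-join {r = r} {g} 0≤r 0≤g = edgewise (λ _ y → 0ℚ ≤ y) {f = join r g} 0≤r 0≤g

  Conserves-netflow-cong : ∀ {k} {b b′ : Fin k → ℚ} {f} → b ≗ b′ → Conserves b f → Conserves b′ f
  Conserves-netflow-cong {f = f} b≗b′ cons v = trans (cong (inflow f v +_) (sym (b≗b′ v))) (cons v)

  Conserves-linear : ∀ {k} a b {β γ : Fin k → ℚ} {f g} → Conserves β f → Conserves γ g →
                     Conserves (linComb a β b γ) (linComb a f b g)
  Conserves-linear a b {β} {γ} {f} {g} cons-f cons-g v = begin
    inflow (linComb a f b g) v + linComb a β b γ v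
      ≡⟨ cong (_+ linComb a β b γ v) (inflow-linear a b f g v) ⟩
    (a * inflow f v + b * inflow g v) + (a * β v + b * γ v)
      ≡⟨ regroup a b (inflow f v) (inflow g v) (β v) (γ v) ⟩
    a * (inflow f v + β v) + b * (inflow g v + γ v)
      ≡⟨ cong₂ (λ x y → a * x + b * y) (cons-f v) (cons-g v) ⟩
    a * outflow f v + b * outflow g v
      ≡⟨ sym (outflow-linear a b f g v) ⟩
    outflow (linComb a f b g) v ∎
    where
    open ≡-Reasoning
    regroup : ∀ a b x y u w → (a * x + b * y) + (a * u + b * w) ≡ a * (x + u) + b * (y + w)
    regroup = solve 6 (λ a b x y u w →
      (a :* x :+ b :* y) :+ (a :* u :+ b :* w) := a :* (x :+ u) :+ b :* (y :+ w)) refl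

  Conserves-split : ∀ {k} {b : Fin (suc k) → ℚ} {f} → Conserves b f →
                    sumℚ (row₀ f) ≡ b zero × Conserves (residual b (row₀ f)) (rest f)
  Conserves-split {b = b} {f} cons = source , λ v → begin
    inflow (rest f) v + (b (suc v) + row₀ f v) ≡⟨ shuffle (inflow (rest f) v) (b (suc v)) (row₀ f v) ⟩
    (row₀ f v + inflow (rest f) v) + b (suc v) ≡⟨ cong (_+ b (suc v)) (sym (inflow-suc f v)) ⟩
    inflow f (suc v) + b (suc v)               ≡⟨ cons (suc v) ⟩
    outflow f (suc v)                          ≡⟨ outflow-suc f v ⟩
    outflow (rest f) v                         ∎
    where
    open ≡-Reasoning
    shuffle : ∀ x y z → x + (y + z) ≡ (z + x) + y
    shuffle = solve 3 (λ x y z → x :+ (y :+ z) := (z :+ x) :+ y) refl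
    source : sumℚ (row₀ f) ≡ b zero
    source = begin
      sumℚ (row₀ f)          ≡⟨ sym (outflow-zero f) ⟩
      outflow f zero         ≡⟨ sym (cons zero) ⟩
      inflow f zero + b zero ≡⟨ cong (_+ b zero) (inflow-zero f) ⟩
      0ℚ + b zero            ≡⟨ ℚ.+-identityˡ (b zero) ⟩
      b zero                 ∎

  Conserves-join : ∀ {k} {b : Fin (suc k) → ℚ} {r g} → sumℚ r ≡ b zero → Conserves (residual b r) g →
                   Conserves b (join r g)
  Conserves-join {b = b} {r} {g} source cons zero = begin
    inflow (join r g) zero + b zero ≡⟨ cong (_+ b zero) (inflow-zero (join r g)) ⟩
    0ℚ + b zero                     ≡⟨ ℚ.+-identityˡ (b zero) ⟩
    b zero                          ≡⟨ sym source ⟩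
    sumℚ r                          ≡⟨ sym (outflow-zero (join r g)) ⟩
    outflow (join r g) zero         ∎
    where open ≡-Reasoning
  Conserves-join {b = b} {r} {g} source cons (suc v) = begin
    inflow (join r g) (suc v) + b (suc v) ≡⟨ cong (_+ b (suc v)) (inflow-suc (join r g) v) ⟩
    (r v + inflow g v) + b (suc v)        ≡⟨ shuffle (r v) (inflow g v) (b (suc v)) ⟩
    inflow g v + (b (suc v) + r v)        ≡⟨ cons v ⟩
    outflow g v                           ≡⟨ sym (outflow-suc (join r g) v) ⟩
    outflow (join r g) (suc v)            ∎
    where
    open ≡-Reasoning
    shuffle : ∀ x y z → (x + y) + z ≡ y + (z + x)
    shuffle = solve 3 (λ x y z → (x :+ y) :+ z := y :+ (z :+ x)) refl

  Conserves-K₁ : ∀ {b : Fin 1 → ℚ} (f : Flow 1) → b zero ≡ 0ℚ → Conserves b f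
  Conserves-K₁ {b} f b₀≡0 zero = begin
    inflow f zero + b zero ≡⟨ cong₂ _+_ (inflow-zero f) b₀≡0 ⟩
    0ℚ + 0ℚ                ≡⟨ sym (outflow-zero f) ⟩
    outflow f zero         ∎
    where open ≡-Reasoning

  InPolytope-rest : ∀ {k} {b : Fin (suc k) → ℚ} {r f} → InPolytope b f → row₀ f ≗ r →
                    InPolytope (residual b r) (rest f)
  InPolytope-rest {b = b} (0≤f , cons) row≗r =
    NonNeg-rest 0≤f ,
    Conserves-netflow-cong (λ v → cong (b (suc v) +_) (row≗r v)) (proj₂ (Conserves-split cons))

  InPolytope-join : ∀ {k} {b : Fin (suc k) → ℚ} {r g} → (∀ j → 0ℚ ≤ r j) → sumℚ r ≡ b zero →
                    InPolytope (residual b r) g → InPolytope b (join r g)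
  InPolytope-join 0≤r source (0≤g , cons) = NonNeg-join 0≤r 0≤g , Conserves-join source cons

  IsVertexℚ-cong : ∀ {k} {b b′ : Fin k → ℚ} {f} → b ≗ b′ → IsVertexℚ b f → IsVertexℚ b′ f
  IsVertexℚ-cong b≗b′ ((0≤f , cons) , extreme) =
    (0≤f , Conserves-netflow-cong b≗b′ cons) ,
    λ g h t (0≤g , cons-g) (0≤h , cons-h) →
      extreme g h t (0≤g , Conserves-netflow-cong (sym ∘ b≗b′) cons-g)
                    (0≤h , Conserves-netflow-cong (sym ∘ b≗b′) cons-h)

  HasNumVerticesℚ-cong : ∀ {k} {b b′ : Fin k → ℚ} {N} → b ≗ b′ →
                         HasNumVerticesℚ b N → HasNumVerticesℚ b′ N
  HasNumVerticesℚ-cong b≗b′ (L , len , enum) =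
    L , len ,
    IsEnumeration-cong _≈_ (λ _ → IsVertexℚ-cong b≗b′) (λ _ → IsVertexℚ-cong (sym ∘ b≗b′)) enum

  -- Scale the first row of g by c′₀ / c₀ and recurse on the rest.
  subflow : ∀ {m} {c c′ : Fin (suc m) → ℚ} {g} → InPolytope c g → NonNegExceptSink c′ →
            (∀ v → c′ (inject₁ v) ≤ c (inject₁ v)) → sumℚ c′ ≡ 0ℚ →
            Σ[ g′ ∈ Flow (suc m) ] InPolytope c′ g′ × (∀ e → g′ e ≤ g e)
  subflow {zero} {c′ = c′} _ _ _ Σc′≡0 =
    (λ _ → 0ℚ) , (K₁-elim , Conserves-K₁ _ (trans (sym (ℚ.+-identityʳ (c′ zero))) Σc′≡0)) , K₁-elim
  subflow {suc m} {c} {c′} {g} (0≤g , cons) 0≤c′ c′≤c Σc′≡0 =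
    join r′ g′ , InPolytope-join 0≤r′ source′ g′∈ , edgewise _≤_ r′≤row g′≤
    where
    open ≡-Reasoning
    ratio = unit-interval-ratio (0≤c′ zero) (c′≤c zero)
    ρ        = proj₁ ratio
    0≤ρ      = proj₁ (proj₂ ratio)
    ρ≤1      = proj₁ (proj₂ (proj₂ ratio))
    ρc₀≡c′₀  = proj₂ (proj₂ (proj₂ ratio))
    r′ : Fin (suc m) → ℚ
    r′ j = ρ * row₀ g j
    0≤r′ : ∀ j → 0ℚ ≤ r′ j
    0≤r′ j = *-nonNeg 0≤ρ (0≤g _)
    r′≤row : ∀ j → r′ j ≤ row₀ g j
    r′≤row j = *-≤-self ρ≤1 (0≤g _)
    source′ : sumℚ r′ ≡ c′ zero
    source′ = begin
      sumℚ r′           ≡⟨ sumℚ-scale ρ (row₀ g) ⟩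
      ρ * sumℚ (row₀ g) ≡⟨ cong (ρ *_) (proj₁ (Conserves-split cons)) ⟩
      ρ * c zero        ≡⟨ ρc₀≡c′₀ ⟩
      c′ zero           ∎
    residual-sum : sumℚ (residual c′ r′) ≡ 0ℚ
    residual-sum = begin
      sumℚ (residual c′ r′)     ≡⟨ sumℚ-+ (c′ ∘ suc) r′ ⟩
      sumℚ (c′ ∘ suc) + sumℚ r′ ≡⟨ cong (sumℚ (c′ ∘ suc) +_) source′ ⟩
      sumℚ (c′ ∘ suc) + c′ zero ≡⟨ ℚ.+-comm (sumℚ (c′ ∘ suc)) (c′ zero) ⟩
      sumℚ c′                   ≡⟨ Σc′≡0 ⟩
      0ℚ                        ∎
    IH = subflow {m} {residual c (row₀ g)} {residual c′ r′} {rest g}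
           (NonNeg-rest 0≤g , proj₂ (Conserves-split cons))
           (λ v → +-nonNeg (0≤c′ (suc v)) (0≤r′ (inject₁ v)))
           (λ v → ℚ.+-mono-≤ (c′≤c (suc v)) (r′≤row (inject₁ v)))
           residual-sum
    g′  = proj₁ IH
    g′∈ = proj₁ (proj₂ IH)
    g′≤ = proj₂ (proj₂ IH)

  vertex-rigid : ∀ {k} {b : Fin k → ℚ} {f D} → IsVertexℚ b f → Conserves (λ _ → 0ℚ) D →
                 NonNeg (linComb 1ℚ f 1ℚ D) → NonNeg (linComb 1ℚ f (- 1ℚ) D) → ∀ e → D e ≡ 0ℚ
  vertex-rigid {b = b} {f} {D} ((_ , cons-f) , extreme) cons-D 0≤f+D 0≤f-D e = begin
    D e                 ≡⟨ half-difference (f e) (D e) ⟩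
    ½ * (f+D e - f-D e) ≡⟨ cong (λ x → ½ * (x - f-D e)) (f+D≈f-D e) ⟩
    ½ * (f-D e - f-D e) ≡⟨ cong (½ *_) (ℚ.+-inverseʳ (f-D e)) ⟩
    ½ * 0ℚ              ≡⟨ ℚ.*-zeroʳ ½ ⟩
    0ℚ                  ∎
    where
    open ≡-Reasoning
    f+D = linComb 1ℚ f 1ℚ D
    f-D = linComb 1ℚ f (- 1ℚ) D
    conserves : ∀ s → Conserves b (linComb 1ℚ f s D)
    conserves s =
      Conserves-netflow-cong (λ v → solve 2 (λ s B → con 1ℚ :* B :+ s :* con 0ℚ := B) refl s (b v))
        (Conserves-linear 1ℚ s cons-f cons-D)
    midpoint : ∀ F d → F ≡ ½ * (1ℚ * F + 1ℚ * d) + (1ℚ - ½) * (1ℚ * F + - 1ℚ * d)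
    midpoint = solve 2 (λ F d → F := con ½ :* (con 1ℚ :* F :+ con 1ℚ :* d)
                                      :+ (con 1ℚ :- con ½) :* (con 1ℚ :* F :+ con (- 1ℚ) :* d)) refl
    half-difference : ∀ F d → d ≡ ½ * ((1ℚ * F + 1ℚ * d) - (1ℚ * F + - 1ℚ * d))
    half-difference = solve 2 (λ F d → d := con ½ :* ((con 1ℚ :* F :+ con 1ℚ :* d)
                                                   :- (con 1ℚ :* F :+ con (- 1ℚ) :* d))) refl
    f+D≈f-D : f+D ≈ f-D
    f+D≈f-D = extreme f+D f-D ½ (0≤f+D , conserves 1ℚ) (0≤f-D , conserves (- 1ℚ))
                (ℚ.positive⁻¹ ½) (toWitness {a? = ½ ℚ.<? 1ℚ} tt) (λ e → midpoint (f e) (D e))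

  -- f ± ½(P − Q) stay nonnegative because 0 ≤ P, Q ≤ f.
  vertex-unique-subflow : ∀ {k} {b β : Fin k → ℚ} {f P Q} → IsVertexℚ b f →
                          InPolytope β P → InPolytope β Q → (∀ e → P e ≤ f e) → (∀ e → Q e ≤ f e) →
                          P ≈ Q
  vertex-unique-subflow {β = β} {f} {P} {Q} vertex@((0≤f , _) , _) (0≤P , cons-P) (0≤Q , cons-Q)
                        P≤f Q≤f e = begin
    P e            ≡⟨ solve 2 (λ x y → x := y :+ con 2ℚ :* (con ½ :* x :+ con -½ :* y)) refl (P e) (Q e) ⟩
    Q e + 2ℚ * D e ≡⟨ cong (λ d → Q e + 2ℚ * d) (D≈0 e) ⟩
    Q e + 2ℚ * 0ℚ  ≡⟨ solve 1 (λ y → y :+ con 2ℚ :* con 0ℚ := y) refl (Q e) ⟩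
    Q e            ∎
    where
    open ≡-Reasoning
    2ℚ = 1ℚ + 1ℚ
    D = linComb ½ P -½ Q
    0≤½ = ℚ.nonNegative⁻¹ ½
    perturbed : ∀ {x y z} → 0ℚ ≤ x → 0ℚ ≤ z → y ≤ z → 0ℚ ≤ ½ * x + (½ * z + ½ * (z - y))
    perturbed 0≤x 0≤z y≤z =
      +-nonNeg (*-nonNeg 0≤½ 0≤x) (+-nonNeg (*-nonNeg 0≤½ 0≤z) (*-nonNeg 0≤½ (p≤q⇒0≤q-p y≤z)))
    plus : ∀ F x y → 1ℚ * F + 1ℚ * (½ * x + -½ * y) ≡ ½ * x + (½ * F + ½ * (F - y))
    plus = solve 3 (λ F x y → con 1ℚ :* F :+ con 1ℚ :* (con ½ :* x :+ con -½ :* y)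
                              := con ½ :* x :+ (con ½ :* F :+ con ½ :* (F :- y))) refl
    minus : ∀ F x y → 1ℚ * F + - 1ℚ * (½ * x + -½ * y) ≡ ½ * y + (½ * F + ½ * (F - x))
    minus = solve 3 (λ F x y → con 1ℚ :* F :+ con (- 1ℚ) :* (con ½ :* x :+ con -½ :* y)
                               := con ½ :* y :+ (con ½ :* F :+ con ½ :* (F :- x))) refl
    D≈0 = vertex-rigid vertex
            (Conserves-netflow-cong (λ v → solve 1 (λ x → con ½ :* x :+ con -½ :* x := con 0ℚ) refl (β v))
              (Conserves-linear ½ -½ cons-P cons-Q))
            (λ e → subst (0ℚ ≤_) (sym (plus (f e) (P e) (Q e))) (perturbed (0≤P e) (0≤f e) (Q≤f e)))
            (λ e → subst (0ℚ ≤_) (sym (minus (f e) (P e) (Q e))) (perturbed (0≤Q e) (0≤f e) (P≤f e)))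

  sourceToSink : ∀ {k} → ℚ → Fin (suc (suc k)) → ℚ
  sourceToSink {k} ε = linComb ε (δ zero) (- ε) (δ (fromℕ (suc k)))

  sourceToSink-residual-inject₁ : ∀ {k} ε (j : Fin (suc k)) v →
                                  residual (sourceToSink ε) (ε ·δ j) (inject₁ v) ≡ (ε ·δ j) (inject₁ v)
  sourceToSink-residual-inject₁ {k} ε j v = begin
    (ε * 0ℚ + - ε * δ (fromℕ k) (inject₁ v)) + ε * δ j (inject₁ v)
      ≡⟨ cong (λ d → (ε * 0ℚ + - ε * d) + ε * δ j (inject₁ v)) (δ-fromℕ-inject₁ v) ⟩
    (ε * 0ℚ + - ε * 0ℚ) + ε * δ j (inject₁ v)
      ≡⟨ solve 2 (λ ε x → (ε :* con 0ℚ :+ (:- ε) :* con 0ℚ) :+ ε :* x := ε :* x) refl ε (δ j (inject₁ v)) ⟩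
    ε * δ j (inject₁ v) ∎
    where open ≡-Reasoning

  sumℚ-sourceToSink-residual : ∀ {k} ε (j : Fin (suc k)) →
                               sumℚ (residual (sourceToSink ε) (ε ·δ j)) ≡ 0ℚ
  sumℚ-sourceToSink-residual {k} ε j = begin
    sumℚ (residual (sourceToSink ε) (ε ·δ j))
      ≡⟨ sumℚ-cong (λ v → reorder ε (δ sink v) (δ j v)) ⟩
    sumℚ (linComb ε (δ j) (- ε) (δ sink))
      ≡⟨ sumℚ-linear ε (- ε) (δ j) (δ sink) ⟩
    ε * sumℚ (δ j) + - ε * sumℚ (δ sink)
      ≡⟨ cong₂ (λ x y → ε * x + - ε * y) (sumℚ-δ j) (sumℚ-δ sink) ⟩
    ε * 1ℚ + - ε * 1ℚ
      ≡⟨ solve 1 (λ ε → ε :* con 1ℚ :+ (:- ε) :* con 1ℚ := con 0ℚ) refl ε ⟩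
    0ℚ ∎
    where
    open ≡-Reasoning
    sink = fromℕ k
    reorder : ∀ ε d x → (ε * 0ℚ + - ε * d) + ε * x ≡ ε * x + - ε * d
    reorder = solve 3 (λ ε d x → (ε :* con 0ℚ :+ (:- ε) :* d) :+ ε :* x := ε :* x :+ (:- ε) :* d) refl

  subflow-via : ∀ {k} {b : Fin (suc (suc k)) → ℚ} {f ε} j → NonNegExceptSink b → InPolytope b f →
                0ℚ ≤ ε → ε ≤ row₀ f j →
                Σ[ P ∈ Flow (suc (suc k)) ]
                  InPolytope (sourceToSink ε) P × (∀ e → P e ≤ f e) × row₀ P ≗ ε ·δ j
  subflow-via {k} {b} {f} {ε} j 0≤b (0≤f , cons) 0≤ε ε≤fj =
    join (ε ·δ j) (proj₁ sub) , InPolytope-join (·δ-nonNeg j 0≤ε) source (proj₁ (proj₂ sub)) ,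
    edgewise _≤_ εδ≤row (proj₂ (proj₂ sub)) , λ _ → refl
    where
    εδ≤row : ∀ i → (ε ·δ j) i ≤ row₀ f i
    εδ≤row = ·δ-≤ j 0≤ε ε≤fj (λ _ → 0≤f _)
    source : sumℚ (ε ·δ j) ≡ sourceToSink {k} ε zero
    source = trans (sumℚ-·δ ε j) (solve 1 (λ ε → ε := ε :* con 1ℚ :+ (:- ε) :* con 0ℚ) refl ε)
    c′≡ = sourceToSink-residual-inject₁ ε j
    sub = subflow {c = residual b (row₀ f)} {residual (sourceToSink ε) (ε ·δ j)} {rest f}
            (NonNeg-rest 0≤f , proj₂ (Conserves-split cons))
            (λ v → subst (0ℚ ≤_) (sym (c′≡ v)) (·δ-nonNeg j 0≤ε (inject₁ v)))
            (λ v → subst (_≤ _) (sym (c′≡ v)) (ℚ.≤-trans (εδ≤row (inject₁ v)) (p≤q+p (0≤b (suc v)))))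
            (sumℚ-sourceToSink-residual ε j)

  vertex-row₀-unique-positive : ∀ {k} {b : Fin (suc (suc k)) → ℚ} {f} → NonNegExceptSink b →
                                IsVertexℚ b f → ∀ {j j′} → j ≢ j′ →
                                0ℚ < row₀ f j → 0ℚ < row₀ f j′ → ⊥
  vertex-row₀-unique-positive {f = f} 0≤b vertex {j} {j′} j≢j′ 0<fj 0<fj′ = ℚ.<-irrefl (sym ε≡0) 0<ε
    where
    ε = row₀ f j ⊓ row₀ f j′
    0<ε : 0ℚ < ε
    0<ε = [ (λ ε≡fj  → subst (0ℚ <_) (sym ε≡fj) 0<fj)
          , (λ ε≡fj′ → subst (0ℚ <_) (sym ε≡fj′) 0<fj′)
          ]′ (ℚ.⊓-sel (row₀ f j) (row₀ f j′))
    ε≤fj : ε ≤ row₀ f j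
    ε≤fj = ℚ.p⊓q≤p (row₀ f j) (row₀ f j′)
    ε≤fj′ : ε ≤ row₀ f j′
    ε≤fj′ = ℚ.p⊓q≤q (row₀ f j) (row₀ f j′)
    ε≡0 : ε ≡ 0ℚ
    ε≡0 =
      let (_ , P∈ , P≤f , row-P) = subflow-via j  0≤b (proj₁ vertex) (ℚ.<⇒≤ 0<ε) ε≤fj
          (_ , Q∈ , Q≤f , row-Q) = subflow-via j′ 0≤b (proj₁ vertex) (ℚ.<⇒≤ 0<ε) ε≤fj′
      in ·δ-separates j≢j′ row-P row-Q (vertex-unique-subflow vertex P∈ Q∈ P≤f Q≤f (zero , suc j , z<s))

  single-positive⇒supported : ∀ {k} (x : Fin (suc k) → ℚ) → (∀ i → 0ℚ ≤ x i) →
                              (∀ {i j} → i ≢ j → 0ℚ < x i → 0ℚ < x j → ⊥) →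
                              Σ[ j ∈ Fin (suc k) ] (∀ i → i ≢ j → x i ≡ 0ℚ)
  single-positive⇒supported x 0≤x unique with Fin.any? (λ i → 0ℚ ℚ.<? x i)
  ... | yes (j , 0<xj) = j , λ i i≢j → ≯0⇒≡0 (λ 0<xi → unique i≢j 0<xi 0<xj)
    where
    ≯0⇒≡0 : ∀ {i} → ¬ 0ℚ < x i → x i ≡ 0ℚ
    ≯0⇒≡0 {i} 0≮xi = ℚ.≤-antisym (ℚ.≮⇒≥ 0≮xi) (0≤x i)
  ... | no ∄0<x = zero , λ i _ → ℚ.≤-antisym (ℚ.≮⇒≥ (λ 0<xi → ∄0<x (i , 0<xi))) (0≤x i)

  row₀-supported : ∀ {k} {b : Fin (suc k) → ℚ} {f} j → Conserves b f →
                   (∀ i → i ≢ j → row₀ f i ≡ 0ℚ) → row₀ f ≗ b zero ·δ j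
  row₀-supported {f = f} j cons off i =
    trans (concentrated (row₀ f) j off i) (cong (λ s → (s ·δ j) i) (proj₁ (Conserves-split cons)))

  vertex-row₀ : ∀ {k} {b : Fin (suc (suc k)) → ℚ} {f} → NonNegExceptSink b → IsVertexℚ b f →
                Σ[ j ∈ Fin (suc k) ] row₀ f ≗ b zero ·δ j
  vertex-row₀ {f = f} 0≤b vertex@((0≤f , cons) , _) = j , row₀-supported j cons off
    where
    support = single-positive⇒supported (row₀ f) (λ _ → 0≤f _) (vertex-row₀-unique-positive 0≤b vertex)
    j   = proj₁ support
    off = proj₂ support

  join-IsVertex : ∀ {k} {b : Fin (suc k) → ℚ} {g} j → 0ℚ ≤ b zero →
                  IsVertexℚ (residual b (b zero ·δ j)) g → IsVertexℚ b (join (b zero ·δ j) g)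
  join-IsVertex {b = b} {g} j 0≤b₀ (g∈ , g-extreme) =
    InPolytope-join (·δ-nonNeg j 0≤b₀) (sumℚ-·δ (b zero) j) g∈ , extreme
    where
    extreme : Extreme b (join (b zero ·δ j) g)
    extreme G H t G∈@(0≤G , cons-G) H∈@(0≤H , cons-H) 0<t t<1 join≈ =
      ≈-from-row₀-rest (λ i → trans (row-G i) (sym (row-H i))) rest-G≈rest-H
      where
      off : ∀ i → i ≢ j → row₀ G i ≡ 0ℚ × row₀ H i ≡ 0ℚ
      off i i≢j = convex≡0 (0≤G _) (0≤H _) 0<t t<1
                    (trans (sym (join≈ (zero , suc i , z<s))) (·δ-offdiag (b zero) (i≢j ∘ sym)))
      row-G = row₀-supported j cons-G (λ i → proj₁ ∘ off i)
      row-H = row₀-supported j cons-H (λ i → proj₂ ∘ off i)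
      rest-G≈rest-H = g-extreme (rest G) (rest H) t (InPolytope-rest G∈ row-G) (InPolytope-rest H∈ row-H)
                        0<t t<1 (λ { (i , i′ , i<i′) → join≈ (suc i , suc i′ , s<s i<i′) })

  rest-IsVertex : ∀ {k} {b : Fin (suc k) → ℚ} {r f} → IsVertexℚ b f → row₀ f ≗ r →
                  IsVertexℚ (residual b r) (rest f)
  rest-IsVertex {b = b} {r} {f} (f∈@(0≤f , cons) , f-extreme) row≗r = InPolytope-rest f∈ row≗r , extreme
    where
    0≤r : ∀ j → 0ℚ ≤ r j
    0≤r j = subst (0ℚ ≤_) (row≗r j) (0≤f _)
    source : sumℚ r ≡ b zero
    source = trans (sumℚ-cong (sym ∘ row≗r)) (proj₁ (Conserves-split cons))
    extreme : Extreme (residual b r) (rest f)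
    extreme g h t g∈ h∈ 0<t t<1 rest≈ (i , i′ , i<i′) =
      f-extreme (join r g) (join r h) t (InPolytope-join 0≤r source g∈) (InPolytope-join 0≤r source h∈)
        0<t t<1 f≈ (suc i , suc i′ , s<s i<i′)
      where
      f≈ : f ≈ convex t (join r g) (join r h)
      f≈ = ≈-from-row₀-rest
             (λ j → trans (row≗r j) (solve 2 (λ t x → x := t :* x :+ (con 1ℚ :- t) :* x) refl t (r j)))
             rest≈

  IsVertexVia : ∀ {k} → (Fin (suc k) → ℚ) → Fin k → Flow (suc k) → Set
  IsVertexVia b j f = IsVertexℚ b f × row₀ f ≗ b zero ·δ j

  enumerate-via : ∀ {k} {b : Fin (suc k) → ℚ} {N} j → 0ℚ ≤ b zero →
                  HasNumVerticesℚ (residual b (b zero ·δ j)) N →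
                  Σ[ L ∈ List (Flow (suc k)) ] length L ≡ N × IsEnumeration _≈_ (IsVertexVia b j) L
  enumerate-via {b = b} j 0≤b₀ (L , len , all , distinct , complete) =
    map (join r) L , trans (length-map (join r) L) len ,
    All.map⁺ (All.map (λ vertex → join-IsVertex j 0≤b₀ vertex , λ _ → refl) all) ,
    AllPairs.map⁺ (AllPairs.map (λ g≉h → g≉h ∘ ≈-rest) distinct) ,
    λ f (vertex , row≗) →
      Any.map⁺ (Any.map (≈-from-row₀-rest row≗) (complete (rest f) (rest-IsVertex vertex row≗)))
    where
    r = b zero ·δ j
    ≈-rest : ∀ {g h} → join r g ≈ join r h → g ≈ h
    ≈-rest join≈ (i , i′ , i<i′) = join≈ (suc i , suc i′ , s<s i<i′)

  vertices-positive-source : ∀ {k} {b : Fin (suc (suc k)) → ℚ} (N : Fin (suc k) → ℕ) →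
                             NonNegExceptSink b → 0ℚ < b zero →
                             (∀ j → HasNumVerticesℚ (residual b (b zero ·δ j)) (N j)) →
                             HasNumVerticesℚ b (sum (tabulate N))
  vertices-positive-source {b = b} N 0≤b 0<b₀ vertices =
    concat (tabulate Ls) ,
    trans (length-concat-tabulate Ls) (cong sum (tabulate-cong (λ j → proj₁ (proj₂ (via j))))) ,
    IsEnumeration-cong _≈_ (λ _ → proj₁ ∘ proj₂) (λ _ → with-row₀)
      (IsEnumeration-concat _≈_ Ls (λ j → proj₂ (proj₂ (via j))) disjoint)
    where
    via = λ j → enumerate-via j (ℚ.<⇒≤ 0<b₀) (vertices j)
    Ls = λ j → proj₁ (via j)
    with-row₀ : ∀ {f} → IsVertexℚ b f → ∃[ j ] IsVertexVia b j f
    with-row₀ vertex = proj₁ (vertex-row₀ 0≤b vertex) , vertex , proj₂ (vertex-row₀ 0≤b vertex)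
    disjoint : ∀ {j j′ f g} → j ≢ j′ → IsVertexVia b j f → IsVertexVia b j′ g → ¬ f ≈ g
    disjoint {j} j≢j′ (_ , row-f) (_ , row-g) f≈g =
      ℚ.<-irrefl (sym (·δ-separates j≢j′ row-f row-g (f≈g (zero , suc j , z<s)))) 0<b₀

  vertices-zero-source : ∀ {k} {b : Fin (suc (suc k)) → ℚ} {N} → NonNegExceptSink b → b zero ≡ 0ℚ →
                         HasNumVerticesℚ (residual b (b zero ·δ zero)) N → HasNumVerticesℚ b N
  vertices-zero-source {b = b} 0≤b b₀≡0 vertices =
    proj₁ via , proj₁ (proj₂ via) ,
    IsEnumeration-cong _≈_ (λ _ → proj₁) (λ _ vertex → vertex , row₀≗0 vertex) (proj₂ (proj₂ via))
    where
    via = enumerate-via zero (0≤b zero) vertices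
    0·δ : ∀ {n} (j i : Fin n) → (b zero ·δ j) i ≡ 0ℚ
    0·δ j i = trans (cong (_* δ j i) b₀≡0) (ℚ.*-zeroˡ (δ j i))
    row₀≗0 : ∀ {f} → IsVertexℚ b f → row₀ f ≗ b zero ·δ zero
    row₀≗0 vertex i = let (j , row≗) = vertex-row₀ 0≤b vertex in
      trans (row≗ i) (trans (0·δ j i) (sym (0·δ zero i)))

  vertices-K₁ : ∀ {b : Fin 1 → ℚ} → b zero ≡ 0ℚ → HasNumVerticesℚ b 1
  vertices-K₁ b₀≡0 = (zeroFlow ∷ []) , refl , (vertex ∷ []) , ([] ∷ []) , λ _ _ → here K₁-elim
    where
    zeroFlow : Flow 1
    zeroFlow _ = 0ℚ
    vertex = (K₁-elim , Conserves-K₁ zeroFlow b₀≡0) , λ _ _ _ _ _ _ _ _ → K₁-elim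

  -- twoUnits i j = δᵢ + δⱼ − 2δ_sink; a unit entering at the sink contributes nothing.  When
  -- vertex 0 sends its supply to vertex l + 1, a unit at vertex 0 advances to l and a unit
  -- elsewhere is only reindexed.
  unitToSink : ∀ {m} → Fin (suc m) → Fin (suc m) → ℚ
  unitToSink {m} i v = δ i v - δ (fromℕ m) v

  twoUnits : ∀ {m} → Fin (suc m) → Fin (suc m) → Fin (suc m) → ℚ
  twoUnits i j v = unitToSink i v + unitToSink j v

  advance : ∀ {m} → Fin (suc (suc m)) → Fin (suc m) → Fin (suc m)
  advance zero    l = l
  advance (suc i) _ = i

  twoUnitsCount : ∀ m → Fin (suc m) → Fin (suc m) → ℕ
  twoUnitsCount zero    _       _       = 1
  twoUnitsCount (suc m) (suc i) (suc j) = twoUnitsCount m i j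
  twoUnitsCount (suc m) i       j       = sum (tabulate λ l → twoUnitsCount m (advance i l) (advance j l))

  unitToSink-residual : ∀ {m} (i : Fin (suc (suc m))) l v →
                        unitToSink (advance i l) v ≡ unitToSink i (suc v) + unitToSink i zero * δ l v
  unitToSink-residual {m} zero l v =
    solve 2 (λ d x → x :- d := (con 0ℚ :- d) :+ (con 1ℚ :- con 0ℚ) :* x) refl (δ (fromℕ m) v) (δ l v)
  unitToSink-residual (suc i) l v =
    solve 2 (λ u x → u := u :+ (con 0ℚ :- con 0ℚ) :* x) refl (unitToSink i v) (δ l v)

  twoUnits-residual : ∀ {m} (i j : Fin (suc (suc m))) l →
                      twoUnits (advance i l) (advance j l) ≗ residual (twoUnits i j) (twoUnits i j zero ·δ l)
  twoUnits-residual i j l v =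
    trans (cong₂ _+_ (unitToSink-residual i l v) (unitToSink-residual j l v))
          (regroup (unitToSink i (suc v)) (unitToSink j (suc v)) (unitToSink i zero) (unitToSink j zero) (δ l v))
    where
    regroup : ∀ a b c d x → (a + c * x) + (b + d * x) ≡ (a + b) + (c + d) * x
    regroup = solve 5 (λ a b c d x → (a :+ c :* x) :+ (b :+ d :* x) := (a :+ b) :+ (c :+ d) :* x) refl

  twoUnits-nonNegExceptSink : ∀ {m} (i j : Fin (suc m)) → NonNegExceptSink (twoUnits i j)
  twoUnits-nonNegExceptSink i j v =
    subst (0ℚ ≤_) (sym (cong₂ _+_ (unitToSink-inject₁ i) (unitToSink-inject₁ j)))
      (+-nonNeg (δ-nonNeg i _) (δ-nonNeg j _))
    where
    unitToSink-inject₁ : ∀ i → unitToSink i (inject₁ v) ≡ δ i (inject₁ v)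
    unitToSink-inject₁ i = trans (cong (λ d → δ i (inject₁ v) - d) (δ-fromℕ-inject₁ v)) (ℚ.+-identityʳ _)

  twoUnits-source-positive : ∀ {m} (j : Fin (suc (suc m))) → 0ℚ < twoUnits zero j zero
  twoUnits-source-positive zero    = ℚ.positive⁻¹ _
  twoUnits-source-positive (suc j) = ℚ.positive⁻¹ _

  twoUnits-vertices : ∀ m (i j : Fin (suc m)) → HasNumVerticesℚ (twoUnits i j) (twoUnitsCount m i j)
  twoUnits-vertices zero    zero    zero    = vertices-K₁ refl
  twoUnits-vertices (suc m) (suc i) (suc j) =
    vertices-zero-source (twoUnits-nonNegExceptSink (suc i) (suc j)) refl
      (HasNumVerticesℚ-cong (twoUnits-residual (suc i) (suc j) zero) (twoUnits-vertices m i j))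
  twoUnits-vertices (suc m) zero    j       =
    vertices-positive-source _ (twoUnits-nonNegExceptSink zero j) (twoUnits-source-positive j) λ l →
      HasNumVerticesℚ-cong (twoUnits-residual zero j l) (twoUnits-vertices m l (advance j l))
  twoUnits-vertices (suc m) (suc i) zero    =
    vertices-positive-source _ (twoUnits-nonNegExceptSink (suc i) zero) (ℚ.positive⁻¹ _) λ l →
      HasNumVerticesℚ-cong (twoUnits-residual (suc i) zero l) (twoUnits-vertices m i l)

  aVec-suc-suc : ∀ k (w : Fin (suc k)) →
                 toℚ (aVec (suc (suc k)) (suc (suc w))) ≡ (0ℚ - δ (fromℕ k) w) + (0ℚ - δ (fromℕ k) w)
  aVec-suc-suc k w with suc (suc (toℕ w)) ℕ.≟ suc (suc k) | w Fin.≟ fromℕ k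
  ... | yes _   | yes refl = cong (λ d → (0ℚ - d) + (0ℚ - d)) (sym (δ-diag (fromℕ k)))
  ... | no _    | no w≢k   = cong (λ d → (0ℚ - d) + (0ℚ - d)) (sym (δ-offdiag (w≢k ∘ sym)))
  ... | yes w≡k | no w≢k   =
    ⊥-elim (w≢k (Fin.toℕ-injective (trans (cong (ℕ.pred ∘ ℕ.pred) w≡k) (sym (Fin.toℕ-fromℕ k)))))
  ... | no w≢k  | yes refl = ⊥-elim (w≢k (cong (λ n → ℕ.suc (ℕ.suc n)) (Fin.toℕ-fromℕ k)))

  twoUnits≗aVec : ∀ k → twoUnits {suc (suc k)} zero (suc zero) ≗ (λ v → toℚ (aVec (suc (suc k)) v))
  twoUnits≗aVec k zero          = refl
  twoUnits≗aVec k (suc zero)    = refl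
  twoUnits≗aVec k (suc (suc w)) = sym (aVec-suc-suc k w)

open FlowPolytopeVertices using (HasNumVerticesℚ-cong; twoUnitsCount; twoUnits-vertices; twoUnits≗aVec)

open import Data.Nat using (ℕ; suc; _≤_; _*_; _^_; _∸_)
open import Data.Nat using (_+_; z≤n; s≤s)
open import Data.Nat.Tactic.RingSolver using (solve-∀)

twoUnitsCount-sym : ∀ m i j → twoUnitsCount m i j ≡ twoUnitsCount m j i
twoUnitsCount-sym zero    i       j       = refl
twoUnitsCount-sym (suc m) zero    zero    = refl
twoUnitsCount-sym (suc m) zero    (suc j) = cong sum (tabulate-cong λ l → twoUnitsCount-sym m l j)
twoUnitsCount-sym (suc m) (suc i) zero    = cong sum (tabulate-cong λ l → twoUnitsCount-sym m i l)
twoUnitsCount-sym (suc m) (suc i) (suc j) = twoUnitsCount-sym m i j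

sum-tabulate-+ : ∀ {m} (f g : Fin m → ℕ) →
                 sum (tabulate λ i → f i + g i) ≡ sum (tabulate f) + sum (tabulate g)
sum-tabulate-+ {zero}  f g = refl
sum-tabulate-+ {suc m} f g =
  trans (cong (f zero + g zero +_) (sum-tabulate-+ (f ∘ suc) (g ∘ suc)))
        (interchange (f zero) (g zero) (sum (tabulate (f ∘ suc))) (sum (tabulate (g ∘ suc))))
  where
  interchange : ∀ a b c d → (a + b) + (c + d) ≡ (a + c) + (b + d)
  interchange = solve-∀

firstRowSum : ℕ → ℕ
firstRowSum m = sum (tabulate (twoUnitsCount m zero))

twoUnitsCount-0-1 : ∀ m → twoUnitsCount (suc m) zero (suc zero) ≡ firstRowSum m
twoUnitsCount-0-1 m = cong sum (tabulate-cong λ l → twoUnitsCount-sym m l zero)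

firstRowSum-suc : ∀ k → firstRowSum (suc (suc k)) ≡ 3 * firstRowSum (suc k)
firstRowSum-suc k = begin
  firstRowSum (suc (suc k))
    ≡⟨⟩ -- twoUnitsCount (2 + k) 0 0 and twoUnitsCount (2 + k) 0 (2 + l) unfold to doubles
  (d + d) + (twoUnitsCount (suc (suc k)) zero (suc zero) + sum (tabulate λ l → a l + a l))
    ≡⟨ cong₂ (λ x y → (d + d) + (x + y)) (twoUnitsCount-0-1 (suc k)) (sum-tabulate-+ a a) ⟩
  (d + d) + ((d + A) + (A + A))
    ≡⟨ triple d A ⟩
  3 * (d + A) ∎
  where
  open ≡-Reasoning
  d = twoUnitsCount (suc k) zero zero
  a = λ l → twoUnitsCount (suc k) zero (suc l)
  A = sum (tabulate a)
  triple : ∀ d A → (d + d) + ((d + A) + (A + A)) ≡ 3 * (d + A)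
  triple = solve-∀

firstRowSum≡2*3^ : ∀ k → firstRowSum (suc k) ≡ 2 * 3 ^ k
firstRowSum≡2*3^ zero    = refl
firstRowSum≡2*3^ (suc k) =
  trans (firstRowSum-suc k) (trans (cong (3 *_) (firstRowSum≡2*3^ k)) (swap (3 ^ k)))
  where
  swap : ∀ x → 3 * (2 * x) ≡ 2 * (3 * x)
  swap = solve-∀

corollary6p4 : (n : ℕ) → 2 ≤ n → HasNumVertices {suc n} (aVec n) (2 * 3 ^ (n ∸ 2))
corollary6p4 (suc (suc k)) (s≤s (s≤s z≤n)) =
  subst (HasNumVertices (aVec (suc (suc k)))) (trans (twoUnitsCount-0-1 (suc k)) (firstRowSum≡2*3^ k))
    (HasNumVerticesℚ-cong (twoUnits≗aVec k) (twoUnits-vertices (suc (suc k)) zero (suc zero)))
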